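{- A tournament $T$ on $\{1,\ldots,n\}$ is alternation acyclic if and only if it contains no alternating cycle of length $4$.
   Context: A tournament on $\{1,\ldots,n\}$ is a directed graph on $\{1,\ldots,n\}$ with, for each pair $i\neq j$, exactly one of the arcs $i\to j$, $j\to i$. An arc $i\to j$ is an ascent if $i<j$ and a descent if $i>j$. A directed cycle $(c_0,\ldots,c_{2k-1})$ is alternating if ascents and descents alternate along it (cyclically). A tournament is alternation acyclic if it contains no alternating directed cycle. -}

module Defs where

open import Data.Nat using (ℕ; zero; suc; _*_; _%_; _≤_)
open import Data.Nat.DivMod using (m%n<n)
open import Data.Fin using (Fin; toℕ; fromℕ<; _<_)
open import Data.Product using (Σ; _×_; ∃-syntax)
open import Data.Sum using (_⊎_)
open import Relation.Nullary using (¬_)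
open import Relation.Binary.PropositionalEquality using (_≡_; _≢_)
open import Function.Definitions using (Injective)

-- A tournament on {1,…,n}, vertices represented by Fin n (the order on
-- Fin n is the order on {1,…,n} shifted by one).
record Tournament (n : ℕ) : Set₁ where
  field
    _⇒_       : Fin n → Fin n → Set
    irrefl    : ∀ i → ¬ (i ⇒ i)
    total     : ∀ i j → i ≢ j → (i ⇒ j) ⊎ (j ⇒ i)
    asym      : ∀ i j → i ⇒ j → ¬ (j ⇒ i)

next : ∀ {m} → Fin (suc m) → Fin (suc m)
next {m} i = fromℕ< (m%n<n (suc (toℕ i)) (suc m))

Ascent : ∀ {n} → Fin n → Fin n → Set
Ascent a b = a < b

Descent : ∀ {n} → Fin n → Fin n → Set
Descent a b = b < a

-- A directed cycle (c_0,…,c_m) of length m+1 in T: distinct vertices with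
-- arcs c_i → c_{i+1 mod (m+1)}.
record DirectedCycle {n : ℕ} (T : Tournament n) (m : ℕ) : Set where
  open Tournament T
  field
    c        : Fin (suc m) → Fin n
    distinct : Injective _≡_ _≡_ c
    arcs     : ∀ i → c i ⇒ c (next i)

IsAlternating : ∀ {n} {T : Tournament n} {m} → DirectedCycle T m → Set
IsAlternating {m = m} C =
  ∀ i → (Ascent (c i) (c (next i)) × Descent (c (next i)) (c (next (next i))))
      ⊎ (Descent (c i) (c (next i)) × Ascent (c (next i)) (c (next (next i))))
  where open DirectedCycle C

HasAlternatingCycleOfLength : ∀ {n} → Tournament n → ℕ → Set
HasAlternatingCycleOfLength T L =
  ∃[ m ] (suc m ≡ L × Σ (DirectedCycle T m) IsAlternating)

HasAlternatingCycle : ∀ {n} → Tournament n → Set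
HasAlternatingCycle T = ∃[ k ] (1 ≤ k × HasAlternatingCycleOfLength T (2 * k))

AlternationAcyclic : ∀ {n} → Tournament n → Set
AlternationAcyclic T = ¬ HasAlternatingCycle T

-- Rotate an alternating cycle of length 2k so that it starts at its smallest
-- vertex v₀.  The first arc is then an ascent, so the odd positions are the
-- peaks; every peak lies above v₀, hence is joined to v₀ by an arc in one
-- direction or the other.  The first peak receives an arc from v₀ and the last
-- one sends an arc to v₀, so some two consecutive peaks p, p′ do the same; with
-- the valley v between them, v₀ → p → v → p′ → v₀ is an alternating 4-cycle.
module Submission where

open import Defs
open import Data.Nat using (ℕ; zero; suc; _+_; _*_; _%_; NonZero; z≤n; s≤s)
open import Data.Nat.DivMod using (%-distribˡ-+; m%n%n≡m%n; [m+n]%n≡m%n; m<n⇒m%n≡m)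
open import Data.Nat.GeneralisedArithmetic using (fold)
import Data.Nat.Properties as ℕ
open import Data.Fin using (Fin; toℕ; _≤_; _<_)
import Data.Fin as Fin
open import Data.Fin.Properties using (toℕ-fromℕ<; toℕ<n; toℕ-injective; ≤∧≢⇒<; <⇒≢; <-asym)
open import Data.Vec using ([]; _∷_; lookup)
open import Data.Vec.Relation.Unary.All using ([]; _∷_)
open import Data.Vec.Relation.Unary.Unique.Propositional.Properties using (lookup-injective)
open import Data.Vec.Relation.Unary.AllPairs using ([]; _∷_)
open import Data.Product using (_×_; _,_; ∃-syntax)
open import Data.Sum using (_⊎_; inj₁; inj₂)
open import Data.Empty using (⊥-elim)
open import Relation.Nullary using (¬_)
open import Relation.Binary.PropositionalEquality
open import Function using (_∘_)

-- Unlike 2 * suc n, double (suc n) reduces to suc (suc (double n)).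
double : ℕ → ℕ
double zero    = zero
double (suc n) = suc (suc (double n))

double≡2* : ∀ n → double n ≡ 2 * n
double≡2* zero    = refl
double≡2* (suc n) = cong suc (begin
  suc (double n)     ≡⟨ cong suc (double≡2* n) ⟩
  suc (n + (n + 0))  ≡⟨ ℕ.+-suc n (n + 0) ⟨
  n + suc (n + 0)    ∎)
  where open ≡-Reasoning

adjacent-crossing : ∀ {P Q : ℕ → Set} → (∀ s → P s ⊎ Q s) → P 0 →
                    ∀ k → Q (suc k) → ∃[ s ] (P s × Q (suc s))
adjacent-crossing dich p₀ zero    q = 0 , p₀ , q
adjacent-crossing dich p₀ (suc k) q with dich (suc k)
... | inj₁ p  = suc k , p , q
... | inj₂ q′ = adjacent-crossing dich p₀ k q′

argmin : ∀ {m n} (f : Fin (suc m) → Fin n) → ∃[ a ] (∀ j → f a ≤ f j)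
argmin {zero}  f = Fin.zero , λ { Fin.zero → ℕ.≤-refl }
argmin {suc m} f with argmin (λ i → f (Fin.suc i))
... | a , fa≤ with ℕ.≤-total (toℕ (f Fin.zero)) (toℕ (f (Fin.suc a)))
... | inj₁ f₀≤fa = Fin.zero , λ { Fin.zero → ℕ.≤-refl ; (Fin.suc j) → ℕ.≤-trans f₀≤fa (fa≤ j) }
... | inj₂ fa≤f₀ = Fin.suc a , λ { Fin.zero → fa≤f₀ ; (Fin.suc j) → fa≤ j }

suc[m%n]%n≡suc[m]%n : ∀ m n .{{_ : NonZero n}} → suc (m % n) % n ≡ suc m % n
suc[m%n]%n≡suc[m]%n m n = begin
  (1 + m % n) % n            ≡⟨ %-distribˡ-+ 1 (m % n) n ⟩
  (1 % n + m % n % n) % n    ≡⟨ cong (λ x → (1 % n + x) % n) (m%n%n≡m%n m n) ⟩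
  (1 % n + m % n) % n        ≡⟨ %-distribˡ-+ 1 m n ⟨
  (1 + m) % n                ∎
  where open ≡-Reasoning

toℕ-fold-next : ∀ {m} (a : Fin (suc m)) i → toℕ (fold a next i) ≡ (toℕ a + i) % suc m
toℕ-fold-next {m} a zero = sym (begin
  (toℕ a + 0) % suc m  ≡⟨ cong (_% suc m) (ℕ.+-identityʳ (toℕ a)) ⟩
  toℕ a % suc m        ≡⟨ m<n⇒m%n≡m (toℕ<n a) ⟩
  toℕ a                ∎)
  where open ≡-Reasoning
toℕ-fold-next {m} a (suc i) = begin
  toℕ (next (fold a next i))           ≡⟨ toℕ-fromℕ< _ ⟩
  suc (toℕ (fold a next i)) % suc m    ≡⟨ cong (λ x → suc x % suc m) (toℕ-fold-next a i) ⟩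
  suc ((toℕ a + i) % suc m) % suc m    ≡⟨ suc[m%n]%n≡suc[m]%n (toℕ a + i) (suc m) ⟩
  suc (toℕ a + i) % suc m              ≡⟨ cong (_% suc m) (ℕ.+-suc (toℕ a) i) ⟨
  (toℕ a + suc i) % suc m              ∎
  where open ≡-Reasoning

fold-next-period : ∀ {m} (a : Fin (suc m)) → fold a next (suc m) ≡ a
fold-next-period {m} a = toℕ-injective (begin
  toℕ (fold a next (suc m))  ≡⟨ toℕ-fold-next a (suc m) ⟩
  (toℕ a + suc m) % suc m    ≡⟨ [m+n]%n≡m%n (toℕ a) (suc m) ⟩
  toℕ a % suc m              ≡⟨ m<n⇒m%n≡m (toℕ<n a) ⟩
  toℕ a                      ∎)
  where open ≡-Reasoning

AlternatesAt : ∀ {n} → (ℕ → Fin n) → ℕ → Set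
AlternatesAt g i =
    (Ascent (g i) (g (suc i)) × Descent (g (suc i)) (g (suc (suc i))))
  ⊎ (Descent (g i) (g (suc i)) × Ascent (g (suc i)) (g (suc (suc i))))

module _ {n} {T : Tournament n} where
  open Tournament T

  ⇒⇒≢ : ∀ {x y} → x ⇒ y → x ≢ y
  ⇒⇒≢ {x} x⇒x refl = irrefl x x⇒x

  ⇒-⇒⇒≢ : ∀ {x y z} → x ⇒ y → y ⇒ z → x ≢ z
  ⇒-⇒⇒≢ x⇒y y⇒z refl = asym _ _ x⇒y y⇒z

  alternating-4-cycle : ∀ {v₀ v₁ v₂ v₃} →
    v₀ ⇒ v₁ → v₁ ⇒ v₂ → v₂ ⇒ v₃ → v₃ ⇒ v₀ →
    v₀ < v₁ → v₂ < v₁ → v₂ < v₃ → v₀ < v₃ →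
    HasAlternatingCycleOfLength T 4
  alternating-4-cycle {v₀} {v₁} {v₂} {v₃} a₀₁ a₁₂ a₂₃ a₃₀ v₀<v₁ v₂<v₁ v₂<v₃ v₀<v₃ =
    3 , refl , cycle , alternating
    where
    cycle : DirectedCycle T 3
    cycle = record
      { c        = lookup (v₀ ∷ v₁ ∷ v₂ ∷ v₃ ∷ [])
      ; distinct = λ {i} {j} → lookup-injective
          ( (⇒⇒≢ a₀₁ ∷ ⇒-⇒⇒≢ a₀₁ a₁₂ ∷ ≢-sym (⇒⇒≢ a₃₀) ∷ [])
          ∷ (⇒⇒≢ a₁₂ ∷ ≢-sym (⇒-⇒⇒≢ a₃₀ a₀₁) ∷ [])
          ∷ (⇒⇒≢ a₂₃ ∷ [])
          ∷ [] ∷ [])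
          i j
      ; arcs     = λ { Fin.zero → a₀₁ ; (Fin.suc Fin.zero) → a₁₂
                     ; (Fin.suc (Fin.suc Fin.zero)) → a₂₃
                     ; (Fin.suc (Fin.suc (Fin.suc Fin.zero))) → a₃₀ } }
    alternating : IsAlternating cycle
    alternating Fin.zero                               = inj₁ (v₀<v₁ , v₂<v₁)
    alternating (Fin.suc Fin.zero)                     = inj₂ (v₂<v₁ , v₂<v₃)
    alternating (Fin.suc (Fin.suc Fin.zero))           = inj₁ (v₂<v₃ , v₀<v₃)
    alternating (Fin.suc (Fin.suc (Fin.suc Fin.zero))) = inj₂ (v₀<v₃ , v₀<v₁)

  module _ {m} (C : DirectedCycle T m) where
    open DirectedCycle C

    walkFrom : Fin (suc m) → ℕ → Fin n
    walkFrom a i = c (fold a next i)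

    walkFrom-step : ∀ a i → walkFrom a i ⇒ walkFrom a (suc i)
    walkFrom-step a i = arcs (fold a next i)

    walkFrom-period : ∀ a → walkFrom a (suc m) ≡ walkFrom a 0
    walkFrom-period a = cong c (fold-next-period a)

    walkFrom-alternates : IsAlternating C → ∀ a i → AlternatesAt (walkFrom a) i
    walkFrom-alternates alternating a i = alternating (fold a next i)

  module FromMinimum (g : ℕ → Fin n) (step : ∀ i → g i ⇒ g (suc i))
                     (alternates : ∀ i → AlternatesAt g i) (minimal : ∀ i → g 0 ≤ g i) where

    ascent⇒descent : ∀ i → g i < g (suc i) → g (suc (suc i)) < g (suc i)
    ascent⇒descent i asc with alternates i
    ... | inj₁ (_ , desc) = desc
    ... | inj₂ (desc , _) = ⊥-elim (<-asym asc desc)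

    descent⇒ascent : ∀ i → g (suc i) < g i → g (suc i) < g (suc (suc i))
    descent⇒ascent i desc with alternates i
    ... | inj₁ (asc , _) = ⊥-elim (<-asym asc desc)
    ... | inj₂ (_ , asc) = asc

    ascent-at-even : ∀ s → g (double s) < g (suc (double s))
    peak-at-odd    : ∀ s → g (suc (suc (double s))) < g (suc (double s))
    ascent-at-even zero    = ≤∧≢⇒< (minimal 1) (⇒⇒≢ (step 0))
    ascent-at-even (suc s) = descent⇒ascent (suc (double s)) (peak-at-odd s)
    peak-at-odd s          = ascent⇒descent (double s) (ascent-at-even s)

    start<odd : ∀ s → g 0 < g (suc (double s))
    start<odd s = ℕ.≤-<-trans (minimal (double s)) (ascent-at-even s)

    peak-dichotomy : ∀ s → (g 0 ⇒ g (suc (double s))) ⊎ (g (suc (double s)) ⇒ g 0)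
    peak-dichotomy s = total _ _ (<⇒≢ (start<odd s))

    closing-arc : ∀ k → g (double (suc k)) ≡ g 0 → g (suc (double k)) ⇒ g 0
    closing-arc k closed = subst (g (suc (double k)) ⇒_) closed (step (suc (double k)))

    closed⇒alternating-4-cycle : ∀ k → g (double (suc k)) ≡ g 0 → HasAlternatingCycleOfLength T 4
    closed⇒alternating-4-cycle zero closed = ⊥-elim (asym _ _ (step 0) (closing-arc 0 closed))
    closed⇒alternating-4-cycle (suc k) closed
      with adjacent-crossing peak-dichotomy (step 0) k (closing-arc (suc k) closed)
    ... | s , start⇒p , p′⇒start =
      alternating-4-cycle start⇒p (step _) (step _) p′⇒start
        (start<odd s) (peak-at-odd s) (ascent-at-even (suc s)) (start<odd (suc s))

alternating-cycle⇒alternating-4-cycle : ∀ {n} {T : Tournament n} →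
  HasAlternatingCycle T → HasAlternatingCycleOfLength T 4
alternating-cycle⇒alternating-4-cycle (zero , () , _)
alternating-cycle⇒alternating-4-cycle (suc k , _ , m , length , C , alternating)
  with argmin (DirectedCycle.c C)
... | a , minimal = FromMinimum.closed⇒alternating-4-cycle (walkFrom C a) (walkFrom-step C a)
  (walkFrom-alternates C alternating a) (λ i → minimal (fold a next i)) k closes
  where
  closes : walkFrom C a (double (suc k)) ≡ walkFrom C a 0
  closes = subst (λ ℓ → walkFrom C a ℓ ≡ walkFrom C a 0)
                 (trans length (sym (double≡2* (suc k)))) (walkFrom-period C a)

corollary2p3 : ∀ (n : ℕ) (T : Tournament n) →
    (AlternationAcyclic T → ¬ HasAlternatingCycleOfLength T 4)
    × (¬ HasAlternatingCycleOfLength T 4 → AlternationAcyclic T)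
corollary2p3 n T =
    (λ acyclic has4 → acyclic (2 , s≤s z≤n , has4))
  , (λ no4 → no4 ∘ alternating-cycle⇒alternating-4-cycle)
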